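{- For every $\phi\in\mathcal{L}$: (1) if $\phi\in\mathsf{IntCK}$ then $\phi\in\mathsf{CK}$; (2) $\phi\in\mathsf{CK}$ iff $\phi\in\mathsf{IntCK}+(\mathrm{Ax0})$.
   Context: $\mathcal{L}$ is built from propositional variables and $\top,\bot$ by $\wedge,\vee,\to$ and connectives $\phi\mathbin{\Box\!\!\to}\psi$, $\phi\mathbin{\Diamond\!\!\to}\psi$; $\neg\phi:=\phi\to\bot$. $\mathsf{IntCK}$ is the set of theorems of the Hilbert system $\mathbb{ICK}$ (equivalently, the formulas valid in all Chellas models) with axioms: (A0) all $\mathcal{L}$-instances of a complete axiomatization of intuitionistic propositional logic; (A1) $((\phi\mathbin{\Box\!\!\to}\psi)\wedge(\phi\mathbin{\Box\!\!\to}\chi))\leftrightarrow(\phi\mathbin{\Box\!\!\to}(\psi\wedge\chi))$; (A2) $((\phi\mathbin{\Diamond\!\!\to}\psi)\wedge(\phi\mathbin{\Box\!\!\to}\chi))\to(\phi\mathbin{\Diamond\!\!\to}(\psi\wedge\chi))$; (A3) $(\phi\mathbin{\Diamond\!\!\to}(\psi\vee\chi))\leftrightarrow((\phi\mathbin{\Diamond\!\!\to}\psi)\vee(\phi\mathbin{\Diamond\!\!\to}\chi))$; (A4) $((\phi\mathbin{\Diamond\!\!\to}\psi)\to(\phi\mathbin{\Box\!\!\to}\chi))\to(\phi\mathbin{\Box\!\!\to}(\psi\to\chi))$; (A5) $\phi\mathbin{\Box\!\!\to}\top$; (A6) $\neg(\phi\mathbin{\Diamond\!\!\to}\bot)$;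 rules: modus ponens; (RA$\Box$) from $\phi\leftrightarrow\psi$ infer $(\phi\mathbin{\Box\!\!\to}\chi)\leftrightarrow(\psi\mathbin{\Box\!\!\to}\chi)$; (RC$\Box$) from $\phi\leftrightarrow\psi$ infer $(\chi\mathbin{\Box\!\!\to}\phi)\leftrightarrow(\chi\mathbin{\Box\!\!\to}\psi)$; (RA$\Diamond$), (RC$\Diamond$) the same with $\mathbin{\Diamond\!\!\to}$. $\mathsf{CK}$ (basic classical conditional logic) is the set of formulas provable from (A0), (A1), (A5), (Ax0) $\phi\vee\neg\phi$, (Ax1) $(\phi\mathbin{\Diamond\!\!\to}\psi)\leftrightarrow\neg(\phi\mathbin{\Box\!\!\to}\neg\psi)$ using modus ponens, (RA$\Box$) and (RC$\Box$). $\mathsf{IntCK}+(\mathrm{Ax0})$ is the set of formulas provable from the axioms of $\mathbb{ICK}$ together with all instances of (Ax0), using the rules of $\mathbb{ICK}$. -}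

module Defs where

open import Data.Nat using (ℕ)
open import Data.Empty using (⊥)
open import Data.Product using (Σ; _,_)
open import Relation.Binary.PropositionalEquality using (_≡_)

infixr 20 _∧'_
infixr 19 _∨'_
infixr 18 _⇒_
infix 17 _□→_ _◇→_
infix 16 _⇔'_

data Fm : Set where
  var  : ℕ → Fm
  ⊤'   : Fm
  ⊥'   : Fm
  _∧'_ : Fm → Fm → Fm
  _∨'_ : Fm → Fm → Fm
  _⇒_  : Fm → Fm → Fm
  _□→_ : Fm → Fm → Fm
  _◇→_ : Fm → Fm → Fm

¬' : Fm → Fm
¬' φ = φ ⇒ ⊥'

_⇔'_ : Fm → Fm → Fm
φ ⇔' ψ = (φ ⇒ ψ) ∧' (ψ ⇒ φ)

-- (A0): a fixed complete Hilbert axiomatization of intuitionistic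
-- propositional logic (with ⊤ and ⊥), all L-instances.
data IPCAx : Fm → Set where
  ax-K   : ∀ φ ψ → IPCAx (φ ⇒ (ψ ⇒ φ))
  ax-S   : ∀ φ ψ χ → IPCAx ((φ ⇒ (ψ ⇒ χ)) ⇒ ((φ ⇒ ψ) ⇒ (φ ⇒ χ)))
  ax-∧E₁ : ∀ φ ψ → IPCAx ((φ ∧' ψ) ⇒ φ)
  ax-∧E₂ : ∀ φ ψ → IPCAx ((φ ∧' ψ) ⇒ ψ)
  ax-∧I  : ∀ φ ψ → IPCAx (φ ⇒ (ψ ⇒ (φ ∧' ψ)))
  ax-∨I₁ : ∀ φ ψ → IPCAx (φ ⇒ (φ ∨' ψ))
  ax-∨I₂ : ∀ φ ψ → IPCAx (ψ ⇒ (φ ∨' ψ))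
  ax-∨E  : ∀ φ ψ χ → IPCAx ((φ ⇒ χ) ⇒ ((ψ ⇒ χ) ⇒ ((φ ∨' ψ) ⇒ χ)))
  ax-⊥E  : ∀ φ → IPCAx (⊥' ⇒ φ)
  ax-⊤I  : IPCAx ⊤'

data Ax0 : Fm → Set where
  ax0 : ∀ φ → Ax0 (φ ∨' ¬' φ)

data ICKAx : Fm → Set where
  A1 : ∀ φ ψ χ → ICKAx (((φ □→ ψ) ∧' (φ □→ χ)) ⇔' (φ □→ (ψ ∧' χ)))
  A2 : ∀ φ ψ χ → ICKAx (((φ ◇→ ψ) ∧' (φ □→ χ)) ⇒ (φ ◇→ (ψ ∧' χ)))
  A3 : ∀ φ ψ χ → ICKAx ((φ ◇→ (ψ ∨' χ)) ⇔' ((φ ◇→ ψ) ∨' (φ ◇→ χ)))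
  A4 : ∀ φ ψ χ → ICKAx (((φ ◇→ ψ) ⇒ (φ □→ χ)) ⇒ (φ □→ (ψ ⇒ χ)))
  A5 : ∀ φ → ICKAx (φ □→ ⊤')
  A6 : ∀ φ → ICKAx (¬' (φ ◇→ ⊥'))

data ICK⊢ (Γ : Fm → Set) : Fm → Set where
  ipc  : ∀ {φ} → IPCAx φ → ICK⊢ Γ φ
  ick  : ∀ {φ} → ICKAx φ → ICK⊢ Γ φ
  extra : ∀ {φ} → Γ φ → ICK⊢ Γ φ
  mp   : ∀ {φ ψ} → ICK⊢ Γ (φ ⇒ ψ) → ICK⊢ Γ φ → ICK⊢ Γ ψ
  RA□  : ∀ {φ ψ} χ → ICK⊢ Γ (φ ⇔' ψ) → ICK⊢ Γ ((φ □→ χ) ⇔' (ψ □→ χ))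
  RC□  : ∀ {φ ψ} χ → ICK⊢ Γ (φ ⇔' ψ) → ICK⊢ Γ ((χ □→ φ) ⇔' (χ □→ ψ))
  RA◇  : ∀ {φ ψ} χ → ICK⊢ Γ (φ ⇔' ψ) → ICK⊢ Γ ((φ ◇→ χ) ⇔' (ψ ◇→ χ))
  RC◇  : ∀ {φ ψ} χ → ICK⊢ Γ (φ ⇔' ψ) → ICK⊢ Γ ((χ ◇→ φ) ⇔' (χ ◇→ ψ))

NoAx : Fm → Set
NoAx _ = ⊥

IntCK : Fm → Set
IntCK = ICK⊢ NoAx

IntCK+Ax0 : Fm → Set
IntCK+Ax0 = ICK⊢ Ax0

data CK : Fm → Set where
  ipc  : ∀ {φ} → IPCAx φ → CK φ
  A1   : ∀ φ ψ χ → CK (((φ □→ ψ) ∧' (φ □→ χ)) ⇔' (φ □→ (ψ ∧' χ)))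
  A5   : ∀ φ → CK (φ □→ ⊤')
  ax0-ck : ∀ φ → CK (φ ∨' ¬' φ)
  ax1-ck : ∀ φ ψ → CK ((φ ◇→ ψ) ⇔' ¬' (φ □→ ¬' ψ))
  mp   : ∀ {φ ψ} → CK (φ ⇒ ψ) → CK φ → CK ψ
  RA□  : ∀ {φ ψ} χ → CK (φ ⇔' ψ) → CK ((φ □→ χ) ⇔' (ψ □→ χ))
  RC□  : ∀ {φ ψ} χ → CK (φ ⇔' ψ) → CK ((χ □→ φ) ⇔' (χ □→ ψ))

{-# OPTIONS --safe #-}
module Submission where

open import Defs
open import Data.Product using (_×_; _,_)
open import Function.Bundles using (_⇔_; mk⇔)
open import Data.List using (List; []; _∷_)
open import Data.List.Membership.Propositional using (_∈_)
open import Data.List.Relation.Unary.Any using (here; there)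
open import Relation.Binary.PropositionalEquality using (refl)

-- Over excluded middle, ◇→ is definable as φ ◇→ ψ ≡ ¬(φ □→ ¬ψ), and CK proves
-- monotonicity of □→ in its consequent (via A1 and RC□).  With these two facts
-- every ICK axiom and the rules RA◇, RC◇ become derivable in CK, so every
-- derivation in ICK (+ Ax0) translates into CK.  Conversely, the only CK
-- axiom missing from IntCK + Ax0 is the duality Ax1: its left-to-right half
-- follows from A2 and A6, its right-to-left half from A4 and excluded middle.

module Deduction (T : Fm → Set)
                 (ipcT : ∀ {φ} → IPCAx φ → T φ)
                 (mpT : ∀ {φ ψ} → T (φ ⇒ ψ) → T φ → T ψ) where

  infix 5 _⊢_
  data _⊢_ (Δ : List Fm) : Fm → Set where
    hyp   : ∀ {φ} → φ ∈ Δ → Δ ⊢ φ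
    thm   : ∀ {φ} → T φ → Δ ⊢ φ
    ⇒-elim : ∀ {φ ψ} → Δ ⊢ (φ ⇒ ψ) → Δ ⊢ φ → Δ ⊢ ψ

  axiom : ∀ {Δ φ} → IPCAx φ → Δ ⊢ φ
  axiom a = thm (ipcT a)

  ⇒-intro : ∀ {Δ φ ψ} → (φ ∷ Δ) ⊢ ψ → Δ ⊢ (φ ⇒ ψ)
  ⇒-intro {φ = φ} (hyp (here refl)) =
    ⇒-elim (⇒-elim (axiom (ax-S φ (φ ⇒ φ) φ)) (axiom (ax-K φ (φ ⇒ φ)))) (axiom (ax-K φ φ))
  ⇒-intro {φ = φ} (hyp {ψ} (there m)) = ⇒-elim (axiom (ax-K ψ φ)) (hyp m)
  ⇒-intro {φ = φ} (thm {ψ} t)         = ⇒-elim (axiom (ax-K ψ φ)) (thm t)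
  ⇒-intro {φ = φ} (⇒-elim {ψ} {χ} d e) =
    ⇒-elim (⇒-elim (axiom (ax-S φ ψ χ)) (⇒-intro d)) (⇒-intro e)

  closed : ∀ {φ} → [] ⊢ φ → T φ
  closed (thm t)      = t
  closed (⇒-elim d e) = mpT (closed d) (closed e)

  weaken : ∀ {Δ φ ψ} → Δ ⊢ φ → (ψ ∷ Δ) ⊢ φ
  weaken (hyp m)      = hyp (there m)
  weaken (thm t)      = thm t
  weaken (⇒-elim d e) = ⇒-elim (weaken d) (weaken e)

  #0 : ∀ {Δ a} → (a ∷ Δ) ⊢ a
  #0 = hyp (here refl)

  #1 : ∀ {Δ a b} → (b ∷ a ∷ Δ) ⊢ a
  #1 = hyp (there (here refl))

  #2 : ∀ {Δ a b c} → (c ∷ b ∷ a ∷ Δ) ⊢ a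
  #2 = hyp (there (there (here refl)))

  ∧-intro : ∀ {Δ a b} → Δ ⊢ a → Δ ⊢ b → Δ ⊢ (a ∧' b)
  ∧-intro {a = a} {b} p q = ⇒-elim (⇒-elim (axiom (ax-∧I a b)) p) q

  ∧-elim₁ : ∀ {Δ a b} → Δ ⊢ (a ∧' b) → Δ ⊢ a
  ∧-elim₁ {a = a} {b} = ⇒-elim (axiom (ax-∧E₁ a b))

  ∧-elim₂ : ∀ {Δ a b} → Δ ⊢ (a ∧' b) → Δ ⊢ b
  ∧-elim₂ {a = a} {b} = ⇒-elim (axiom (ax-∧E₂ a b))

  ∨-intro₁ : ∀ {Δ a b} → Δ ⊢ a → Δ ⊢ (a ∨' b)
  ∨-intro₁ {a = a} {b} = ⇒-elim (axiom (ax-∨I₁ a b))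

  ∨-intro₂ : ∀ {Δ a b} → Δ ⊢ b → Δ ⊢ (a ∨' b)
  ∨-intro₂ {a = a} {b} = ⇒-elim (axiom (ax-∨I₂ a b))

  ∨-elim : ∀ {Δ a b c} → Δ ⊢ (a ∨' b) → (a ∷ Δ) ⊢ c → (b ∷ Δ) ⊢ c → Δ ⊢ c
  ∨-elim {a = a} {b} {c} d l r =
    ⇒-elim (⇒-elim (⇒-elim (axiom (ax-∨E a b c)) (⇒-intro l)) (⇒-intro r)) d

  ⊥-elim : ∀ {Δ a} → Δ ⊢ ⊥' → Δ ⊢ a
  ⊥-elim {a = a} = ⇒-elim (axiom (ax-⊥E a))

  ⇔-elim₁ : ∀ {Δ a b} → Δ ⊢ (a ⇔' b) → Δ ⊢ a → Δ ⊢ b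
  ⇔-elim₁ e = ⇒-elim (∧-elim₁ e)

  ⇔-elim₂ : ∀ {Δ a b} → Δ ⊢ (a ⇔' b) → Δ ⊢ b → Δ ⊢ a
  ⇔-elim₂ e = ⇒-elim (∧-elim₂ e)

  module Classical (lemT : ∀ φ → T (φ ∨' ¬' φ)) where

    by-cases : ∀ {Δ c} a → (a ∷ Δ) ⊢ c → (¬' a ∷ Δ) ⊢ c → Δ ⊢ c
    by-cases a = ∨-elim (thm (lemT a))

    ¬¬-elim : ∀ {Δ a} → Δ ⊢ ¬' (¬' a) → Δ ⊢ a
    ¬¬-elim {a = a} nn = by-cases a #0 (⊥-elim (⇒-elim (weaken nn) #0))

module CK-Deduction = Deduction CK ipc mp
open CK-Deduction using () renaming (_⊢_ to _⊢ᶜᵏ_)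

module _ where
  open CK-Deduction
  open Classical ax0-ck

  □-mono : ∀ {Δ a b} χ → CK (a ⇒ b) → Δ ⊢ᶜᵏ (χ □→ a) → Δ ⊢ᶜᵏ (χ □→ b)
  □-mono {a = a} {b} χ ab d = ∧-elim₂ (⇔-elim₂ (thm (A1 χ a b)) (⇔-elim₁ (thm a□→a∧b) d))
    where
    a⇔a∧b : CK (a ⇔' (a ∧' b))
    a⇔a∧b = closed (∧-intro (⇒-intro (∧-intro #0 (⇒-elim (thm ab) #0)))
                            (⇒-intro (∧-elim₁ #0)))
    a□→a∧b : CK ((χ □→ a) ⇔' (χ □→ (a ∧' b)))
    a□→a∧b = RC□ χ a⇔a∧b

  ◇→⇒¬□→¬ : ∀ {Δ φ ψ} → Δ ⊢ᶜᵏ (φ ◇→ ψ) → Δ ⊢ᶜᵏ ¬' (φ □→ ¬' ψ)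
  ◇→⇒¬□→¬ {φ = φ} {ψ} = ⇔-elim₁ (thm (ax1-ck φ ψ))

  ¬□→¬⇒◇→ : ∀ {Δ φ ψ} → Δ ⊢ᶜᵏ ¬' (φ □→ ¬' ψ) → Δ ⊢ᶜᵏ (φ ◇→ ψ)
  ¬□→¬⇒◇→ {φ = φ} {ψ} = ⇔-elim₂ (thm (ax1-ck φ ψ))

  ¬◇→⇒□→¬ : ∀ {Δ φ ψ} → Δ ⊢ᶜᵏ ¬' (φ ◇→ ψ) → Δ ⊢ᶜᵏ (φ □→ ¬' ψ)
  ¬◇→⇒□→¬ n = ¬¬-elim (⇒-intro (⇒-elim (weaken n) (¬□→¬⇒◇→ #0)))

  contraposition : ∀ {a b} → CK (a ⇒ b) → CK (¬' b ⇒ ¬' a)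
  contraposition ab = closed (⇒-intro (⇒-intro (⇒-elim #1 (⇒-elim (thm ab) #0))))

  ◇-mono : ∀ {Δ a b} χ → CK (a ⇒ b) → Δ ⊢ᶜᵏ (χ ◇→ a) → Δ ⊢ᶜᵏ (χ ◇→ b)
  ◇-mono χ ab d =
    ¬□→¬⇒◇→ (⇒-intro (⇒-elim (◇→⇒¬□→¬ (weaken d)) (□-mono χ (contraposition ab) #0)))

  ¬-cong : ∀ {a b} → CK (a ⇔' b) → CK (¬' a ⇔' ¬' b)
  ¬-cong e = closed (∧-intro (⇒-intro (⇒-intro (⇒-elim #1 (⇔-elim₂ (thm e) #0))))
                             (⇒-intro (⇒-intro (⇒-elim #1 (⇔-elim₁ (thm e) #0)))))

  A2-CK : ∀ φ ψ χ → CK (((φ ◇→ ψ) ∧' (φ □→ χ)) ⇒ (φ ◇→ (ψ ∧' χ)))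
  A2-CK φ ψ χ = closed (⇒-intro (¬□→¬⇒◇→ (⇒-intro
    (⇒-elim (◇→⇒¬□→¬ (∧-elim₁ #1))
      (□-mono φ χ∧¬[ψ∧χ]⇒¬ψ (⇔-elim₁ (thm (A1 φ χ (¬' (ψ ∧' χ)))) (∧-intro (∧-elim₂ #1) #0)))))))
    where
    χ∧¬[ψ∧χ]⇒¬ψ : CK ((χ ∧' ¬' (ψ ∧' χ)) ⇒ ¬' ψ)
    χ∧¬[ψ∧χ]⇒¬ψ = closed (⇒-intro (⇒-intro (⇒-elim (∧-elim₂ #1) (∧-intro #0 (∧-elim₁ #1)))))

  A3-CK : ∀ φ ψ χ → CK ((φ ◇→ (ψ ∨' χ)) ⇔' ((φ ◇→ ψ) ∨' (φ ◇→ χ)))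
  A3-CK φ ψ χ = closed (∧-intro
    (⇒-intro (by-cases (φ ◇→ ψ) (∨-intro₁ #0) (by-cases (φ ◇→ χ) (∨-intro₂ #0)
      (⊥-elim (⇒-elim (◇→⇒¬□→¬ #2)
        (□-mono φ ¬ψ∧¬χ⇒¬[ψ∨χ]
          (⇔-elim₁ (thm (A1 φ (¬' ψ) (¬' χ))) (∧-intro (¬◇→⇒□→¬ #1) (¬◇→⇒□→¬ #0)))))))))
    (⇒-intro (∨-elim #0 (◇-mono φ (ipc (ax-∨I₁ ψ χ)) #0) (◇-mono φ (ipc (ax-∨I₂ ψ χ)) #0))))
    where
    ¬ψ∧¬χ⇒¬[ψ∨χ] : CK ((¬' ψ ∧' ¬' χ) ⇒ ¬' (ψ ∨' χ))
    ¬ψ∧¬χ⇒¬[ψ∨χ] =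
      closed (⇒-intro (⇒-intro (∨-elim #0 (⇒-elim (∧-elim₁ #2) #0) (⇒-elim (∧-elim₂ #2) #0))))

  A4-CK : ∀ φ ψ χ → CK (((φ ◇→ ψ) ⇒ (φ □→ χ)) ⇒ (φ □→ (ψ ⇒ χ)))
  A4-CK φ ψ χ = closed (⇒-intro (by-cases (φ ◇→ ψ)
    (□-mono φ (ipc (ax-K χ ψ)) (⇒-elim #1 #0))
    (□-mono φ ¬ψ⇒ψ⇒χ (¬◇→⇒□→¬ #0))))
    where
    ¬ψ⇒ψ⇒χ : CK (¬' ψ ⇒ (ψ ⇒ χ))
    ¬ψ⇒ψ⇒χ = closed (⇒-intro (⇒-intro (⊥-elim (⇒-elim #1 #0))))

  A6-CK : ∀ φ → CK (¬' (φ ◇→ ⊥'))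
  A6-CK φ = closed (⇒-intro (⇒-elim (◇→⇒¬□→¬ #0) (□-mono φ ⊤⇒¬⊥ (thm (A5 φ)))))
    where
    ⊤⇒¬⊥ : CK (⊤' ⇒ ¬' ⊥')
    ⊤⇒¬⊥ = closed (⇒-intro (⇒-intro #0))

  RA◇-CK : ∀ {a b} χ → CK (a ⇔' b) → CK ((a ◇→ χ) ⇔' (b ◇→ χ))
  RA◇-CK χ e = closed (∧-intro
    (⇒-intro (¬□→¬⇒◇→ (⇒-intro (⇒-elim (◇→⇒¬□→¬ #1) (⇔-elim₂ (thm (RA□ (¬' χ) e)) #0)))))
    (⇒-intro (¬□→¬⇒◇→ (⇒-intro (⇒-elim (◇→⇒¬□→¬ #1) (⇔-elim₁ (thm (RA□ (¬' χ) e)) #0))))))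

  RC◇-CK : ∀ {a b} χ → CK (a ⇔' b) → CK ((χ ◇→ a) ⇔' (χ ◇→ b))
  RC◇-CK χ e = closed (∧-intro
    (⇒-intro (¬□→¬⇒◇→ (⇒-intro (⇒-elim (◇→⇒¬□→¬ #1) (⇔-elim₂ (thm (RC□ χ (¬-cong e))) #0)))))
    (⇒-intro (¬□→¬⇒◇→ (⇒-intro (⇒-elim (◇→⇒¬□→¬ #1) (⇔-elim₁ (thm (RC□ χ (¬-cong e))) #0))))))

ICKAx⇒CK : ∀ {φ} → ICKAx φ → CK φ
ICKAx⇒CK (A1 φ ψ χ) = A1 φ ψ χ
ICKAx⇒CK (A2 φ ψ χ) = A2-CK φ ψ χ
ICKAx⇒CK (A3 φ ψ χ) = A3-CK φ ψ χ
ICKAx⇒CK (A4 φ ψ χ) = A4-CK φ ψ χ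
ICKAx⇒CK (A5 φ)     = A5 φ
ICKAx⇒CK (A6 φ)     = A6-CK φ

ICK⊢⇒CK : ∀ {Γ} → (∀ {φ} → Γ φ → CK φ) → ∀ {φ} → ICK⊢ Γ φ → CK φ
ICK⊢⇒CK Γ⊆CK (ipc a)   = ipc a
ICK⊢⇒CK Γ⊆CK (ick a)   = ICKAx⇒CK a
ICK⊢⇒CK Γ⊆CK (extra x) = Γ⊆CK x
ICK⊢⇒CK Γ⊆CK (mp d e)  = mp (ICK⊢⇒CK Γ⊆CK d) (ICK⊢⇒CK Γ⊆CK e)
ICK⊢⇒CK Γ⊆CK (RA□ χ d) = RA□ χ (ICK⊢⇒CK Γ⊆CK d)
ICK⊢⇒CK Γ⊆CK (RC□ χ d) = RC□ χ (ICK⊢⇒CK Γ⊆CK d)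
ICK⊢⇒CK Γ⊆CK (RA◇ χ d) = RA◇-CK χ (ICK⊢⇒CK Γ⊆CK d)
ICK⊢⇒CK Γ⊆CK (RC◇ χ d) = RC◇-CK χ (ICK⊢⇒CK Γ⊆CK d)

IntCK⇒CK : ∀ {φ} → IntCK φ → CK φ
IntCK⇒CK = ICK⊢⇒CK λ ()

IntCK+Ax0⇒CK : ∀ {φ} → IntCK+Ax0 φ → CK φ
IntCK+Ax0⇒CK = ICK⊢⇒CK λ { (ax0 φ) → ax0-ck φ }

Ax1-IntCK+Ax0 : ∀ φ ψ → IntCK+Ax0 ((φ ◇→ ψ) ⇔' ¬' (φ □→ ¬' ψ))
Ax1-IntCK+Ax0 φ ψ = closed (∧-intro
    (⇒-intro (⇒-intro (⇒-elim (thm (ick (A6 φ)))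
      (⇔-elim₁ (thm (RC◇ φ ψ∧¬ψ⇔⊥)) (⇒-elim (thm (ick (A2 φ ψ (¬' ψ)))) (∧-intro #1 #0))))))
    (⇒-intro (¬¬-elim (⇒-intro (⇒-elim #1
      (⇒-elim (thm (ick (A4 φ ψ ⊥'))) (⇒-intro (⊥-elim (⇒-elim #1 #0)))))))))
  where
  open Deduction IntCK+Ax0 ipc mp
  open Classical (λ φ → extra (ax0 φ))
  ψ∧¬ψ⇔⊥ : IntCK+Ax0 ((ψ ∧' ¬' ψ) ⇔' ⊥')
  ψ∧¬ψ⇔⊥ = closed (∧-intro (⇒-intro (⇒-elim (∧-elim₂ #0) (∧-elim₁ #0))) (⇒-intro (⊥-elim #0)))

CK⇒IntCK+Ax0 : ∀ {φ} → CK φ → IntCK+Ax0 φ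
CK⇒IntCK+Ax0 (ipc a)      = ipc a
CK⇒IntCK+Ax0 (A1 φ ψ χ)   = ick (A1 φ ψ χ)
CK⇒IntCK+Ax0 (A5 φ)       = ick (A5 φ)
CK⇒IntCK+Ax0 (ax0-ck φ)   = extra (ax0 φ)
CK⇒IntCK+Ax0 (ax1-ck φ ψ) = Ax1-IntCK+Ax0 φ ψ
CK⇒IntCK+Ax0 (mp d e)     = mp (CK⇒IntCK+Ax0 d) (CK⇒IntCK+Ax0 e)
CK⇒IntCK+Ax0 (RA□ χ d)    = RA□ χ (CK⇒IntCK+Ax0 d)
CK⇒IntCK+Ax0 (RC□ χ d)    = RC□ χ (CK⇒IntCK+Ax0 d)

proposition2 : (φ : Fm) → (IntCK φ → CK φ) × (CK φ ⇔ IntCK+Ax0 φ)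
proposition2 φ = IntCK⇒CK , mk⇔ CK⇒IntCK+Ax0 IntCK+Ax0⇒CK
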